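{- For every graph $G$ and every integer $d\ge 1$, we have $\chi_{\mathrm{sub}}(G^d)\le \operatorname{gcol}_{d,2d}(G)$. Moreover, if $d$ is odd, then $\chi_{\mathrm{sub}}(G^d)\le \operatorname{gcol}_{d,2d-1}(G)$.
   Context: All graphs are finite and simple. For a graph $G$ and integer $d\ge1$, the $d$-th power $G^d$ has vertex set $V(G)$, with $uv$ an edge (for $u\neq v$) iff $G$ has a $u$–$v$ path of length at most $d$. A $k$-subcolouring of $G$ is a map $f:V(G)\to\{0,\dots,k-1\}$ such that for each $i$ the set of vertices coloured $i$ induces a disjoint union of cliques; $\chi_{\mathrm{sub}}(G)$ is the least $k$ for which a $k$-subcolouring exists. Generalised colouring numbers: for $k,\ell\in\mathbb N\cup\{\infty\}$, a linear ordering $\sigma$ of $V(G)$ and vertices $u\le_\sigma v$, $u$ is $k$-hop $\ell$-reachable from $v$ if there is a path $x_0x_1\dots x_s$ with $x_0=v$, $x_s=u$, $s\le \ell$, such that $u<_\sigma x_{i-1}$ for every $i\in\{1,\dots,s\}$, and such that $|\{j\in\{1,\dots,s\}: x_j<_\sigma x_{i-1}\text{ for every } i\in\{1,\dots,j\}\}|\le k$. (In particular $v$ is reachable from itself via $s=0$.) Let $\operatorname{GReach}_{k,\ell}[G,\sigma,v]$ be the set of such $u$, $\operatorname{gcol}_{k,\ell}(G,\sigma)=\max_v|\operatorname{GReach}_{k,\ell}[G,\sigma,v]|$, and $\operatorname{gcol}_{k,\ell}(G)$ the minimum of $\operatorname{gcol}_{k,\ell}(G,\sigma)$ over all linear orderings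 $\sigma$ of $V(G)$. -}

module Defs where

open import Level using (0ℓ)
open import Data.Nat using (ℕ; zero; suc; _+_; _*_; _∸_; _≤_; _<_)
import Data.Nat as ℕ
open import Data.Fin using (Fin; zero; suc; toℕ; inject₁; fromℕ)
open import Data.Fin.Properties using (all?)
open import Data.List using (List; length; filter)
open import Data.Fin.Base using () renaming (_<_ to _<ᶠ_; _≤_ to _≤ᶠ_)
import Data.Fin.Properties as FinP
open import Data.Product using (Σ; _×_; _,_)
open import Data.Sum using (_⊎_)
open import Relation.Nullary using (¬_; Dec; _→-dec_)
open import Relation.Binary.PropositionalEquality using (_≡_; _≢_)
open import Function.Definitions using (Injective)

record Graph : Set₁ where
  field
    n      : ℕ
    Adj    : Fin n → Fin n → Set
    Adj?   : (u v : Fin n) → Dec (Adj u v)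
    sym    : ∀ {u v} → Adj u v → Adj v u
    irrefl : ∀ {u} → ¬ Adj u u

open Graph public

record Path (G : Graph) (s : ℕ) : Set where
  field
    vert     : Fin (suc s) → Fin (n G)
    distinct : Injective _≡_ _≡_ vert
    edges    : (i : Fin s) → Adj G (vert (inject₁ i)) (vert (suc i))

  start : Fin (n G)
  start = vert zero

  end : Fin (n G)
  end = vert (fromℕ s)

open Path public

PowAdj : (G : Graph) → ℕ → Fin (n G) → Fin (n G) → Set
PowAdj G d u v =
  u ≢ v × Σ ℕ λ s → s ≤ d × Σ (Path G s) λ p → start p ≡ u × end p ≡ v

-- A colour class induces a disjoint union of cliques
-- iff every connected component of the induced subgraph is a clique:
-- any two vertices of colour i joined by a walk inside colour class i
-- are equal or adjacent.

module _ {V : Set} (R : V → V → Set) {k : ℕ} (f : V → Fin k) where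

  data ClassWalk (i : Fin k) : V → V → Set where
    here : ∀ {u} → f u ≡ i → ClassWalk i u u
    step : ∀ {u v w} → f u ≡ i → R u v → ClassWalk i v w → ClassWalk i u w

  IsSubcolouring : Set
  IsSubcolouring =
    ∀ (i : Fin k) (u w : V) → ClassWalk i u w → u ≡ w ⊎ R u w

HasSubcolouringPow : (G : Graph) (d k : ℕ) → Set
HasSubcolouringPow G d k =
  Σ (Fin (n G) → Fin k) λ f → IsSubcolouring (PowAdj G d) f

-- Linear orderings of V(G): an injective (hence bijective) position map.

record Ordering (G : Graph) : Set where
  field
    pos    : Fin (n G) → Fin (n G)
    pos-inj : Injective _≡_ _≡_ pos

open Ordering public

_<[_]_ : {G : Graph} → Fin (n G) → Ordering G → Fin (n G) → Set
u <[ σ ] v = pos σ u <ᶠ pos σ v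

_≤[_]_ : {G : Graph} → Fin (n G) → Ordering G → Fin (n G) → Set
u ≤[ σ ] v = pos σ u ≤ᶠ pos σ v

-- Hops of a path x₀…xₛ w.r.t. σ: the indices j ∈ {1,…,s} such that
-- x_j <σ x_{i-1} for every i ∈ {1,…,j}.  Index j ∈ {1..s} is encoded as
-- suc j' with j' : Fin s; i-1 ranges over indices t with toℕ t < j.

IsHop : {G : Graph} (σ : Ordering G) {s : ℕ} (p : Path G s) → Fin s → Set
IsHop σ {s} p j' =
  (t : Fin (suc s)) → toℕ t < toℕ (suc j') → vert p (suc j') <[ σ ] vert p t

isHop? : {G : Graph} (σ : Ordering G) {s : ℕ} (p : Path G s) →
         (j' : Fin s) → Dec (IsHop σ p j')
isHop? σ p j' = all? λ t →
  (toℕ t ℕ.<? toℕ (suc j')) →-dec (pos σ (vert p (suc j')) FinP.<? pos σ (vert p t))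

hops : {G : Graph} (σ : Ordering G) {s : ℕ} → Path G s → ℕ
hops σ {s} p = length (filter (isHop? σ p) (Data.List.allFin s))
  where import Data.List

GReach : (k ℓ : ℕ) (G : Graph) (σ : Ordering G) → Fin (n G) → Fin (n G) → Set
GReach k ℓ G σ v u =
  u ≤[ σ ] v ×
  Σ ℕ λ s → s ≤ ℓ × Σ (Path G s) λ p →
    start p ≡ v × end p ≡ u ×
    ((i : Fin s) → u <[ σ ] vert p (inject₁ i)) ×
    hops σ p ≤ k

-- |P| ≤ m for a predicate P on vertices: an injection (on vertices)
-- of {u ∣ P u} into Fin m.

AtMost : {A : Set} → ℕ → (A → Set) → Set
AtMost {A} m P =
  Σ ((a : A) → P a → Fin m) λ g →
    ∀ a b (pa : P a) (pb : P b) → g a pa ≡ g b pb → a ≡ b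

GcolAtMost : (k ℓ : ℕ) (G : Graph) (σ : Ordering G) (m : ℕ) → Set
GcolAtMost k ℓ G σ m = ∀ v → AtMost m (GReach k ℓ G σ v)

-- Let ρ = ⌊d/2⌋ and give every vertex the colour of its root, the σ-least
-- vertex within distance ρ of it.  Call two roots in conflict if some of
-- their vertices are within distance d.  For an earlier conflicting root z'
-- of z, the walk z → a → b → z' (root to vertex, vertex to vertex, vertex to
-- root), with the middle part split after ρ steps, has length at most d + 2ρ
-- (that is 2d, or 2d − 1 for odd d); its vertices are all σ-above z', and
-- those σ-below z lie on its last d steps, which bounds the hops by d.  So
-- each root, together with its earlier conflicting roots, lies in its own
-- GReach set, and greedy colouring along σ gives conflicting roots distinct
-- colours.  Then G^d-adjacent vertices of equal colour share their root, so
-- a connected colour class lies within distance 2ρ ≤ d of one root and is a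
-- clique of G^d.
module Submission where

open import Defs
open import Data.Nat using (ℕ; zero; suc; _+_; _*_; _∸_; _%_; _≤_; _<_; z≤n; s≤s; ⌊_/2⌋; ⌈_/2⌉)
import Data.Nat as ℕ
open import Data.Nat.Properties
  using (≤-refl; ≤-reflexive; ≤-trans; <⇒≤; ≤⇒≯; <-irrefl; <-≤-trans; ≤∧≢⇒<; ≤-pred; n≤1+n; m≤n⇒m≤1+n;
         +-comm; +-suc; +-identityʳ; +-mono-≤; +-monoʳ-≤; ⌊n/2⌋-mono; ⌊n/2⌋≤⌈n/2⌉; ⌊n/2⌋+⌈n/2⌉≡n; module ≤-Reasoning)
open import Data.Nat.Tactic.RingSolver using (solve-∀)
open import Data.Fin using (Fin; zero; suc; toℕ; inject₁; fromℕ)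
import Data.Fin.Properties as Fin
open import Data.List using (List; []; _∷_; _++_; length; map; filter; allFin; lookup)
open import Data.List.Properties using (length-++; length-++-sucʳ; length-map)
open import Data.List.Membership.Propositional using (_∈_)
open import Data.List.Membership.Propositional.Properties
  using (∈-++⁻; ∈-++⁺ˡ; ∈-++⁺ʳ; ∈-∃++; ∈-lookup; ∈-map⁻; ∈-filter⁺; ∈-filter⁻; ∈-allFin)
open import Data.List.Relation.Unary.Any as Any using (here; there)
open import Data.List.Relation.Unary.All as All using ([])
open import Data.List.Relation.Unary.All.Properties using (¬Any⇒All¬; all-filter)
open import Data.List.Relation.Unary.AllPairs using ([]; _∷_)
open import Data.List.Relation.Unary.Unique.Propositional using (Unique)
import Data.List.Relation.Unary.Unique.Propositional.Properties as Unique
open import Data.List.Relation.Binary.Subset.Propositional using (_⊆_)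
open import Data.List.Extrema.Nat using (argmin; argmin-all; f[argmin]≤f[xs])
open import Data.Vec.Functional using (updateAt)
open import Data.Vec.Functional.Properties using (updateAt-updates; updateAt-minimal)
open import Data.Product using (Σ; ∃; _×_; _,_; proj₁; proj₂)
open import Data.Sum using (_⊎_; inj₁; inj₂; [_,_]′)
open import Data.Empty using (⊥-elim)
open import Function using (_∘_; const; id)
open import Function.Definitions using (Injective)
open import Relation.Nullary using (Dec; yes; no; contradiction; _×-dec_)
open import Relation.Binary.Definitions using (tri<; tri≈; tri>)
open import Relation.Binary.PropositionalEquality as ≡ using (_≡_; _≢_; refl; trans; cong; subst)

private
  variable
    A : Set

lookup-injective : {xs : List A} → Unique xs → ∀ {i j} → lookup xs i ≡ lookup xs j → i ≡ j
lookup-injective (_ ∷ _) {zero} {zero} _ = refl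
lookup-injective (x∉xs ∷ _) {zero} {suc j} e = contradiction e (All.lookup x∉xs (∈-lookup j))
lookup-injective (x∉xs ∷ _) {suc i} {zero} e = contradiction (≡.sym e) (All.lookup x∉xs (∈-lookup i))
lookup-injective (_ ∷ xs!) {suc i} {suc j} e = cong suc (lookup-injective xs! e)

unique-⊆⇒length≤ : {xs ys : List A} → Unique xs → xs ⊆ ys → length xs ≤ length ys
unique-⊆⇒length≤ {xs = []} _ _ = z≤n
unique-⊆⇒length≤ {xs = x ∷ xs} (x∉xs ∷ xs!) xs⊆ys with ∈-∃++ (xs⊆ys (here refl))
... | as , bs , refl = begin
  suc (length xs)         ≤⟨ s≤s (unique-⊆⇒length≤ xs! xs⊆as++bs) ⟩
  suc (length (as ++ bs)) ≡⟨ length-++-sucʳ as x bs ⟨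
  length (as ++ x ∷ bs)   ∎
  where
  open ≤-Reasoning
  xs⊆as++bs : xs ⊆ as ++ bs
  xs⊆as++bs y∈xs with ∈-++⁻ as (xs⊆ys (there y∈xs))
  ... | inj₁ y∈as = ∈-++⁺ˡ y∈as
  ... | inj₂ (here refl) = contradiction refl (All.lookup x∉xs y∈xs)
  ... | inj₂ (there y∈bs) = ∈-++⁺ʳ as y∈bs

AtMost-mono : {P Q : A → Set} {m : ℕ} → (∀ a → Q a → P a) → AtMost m P → AtMost m Q
AtMost-mono Q⇒P (g , g-inj) = (λ a q → g a (Q⇒P a q)) , λ a b qa qb → g-inj a b (Q⇒P a qa) (Q⇒P b qb)

classWalk-head : {V : Set} {R : V → V → Set} {k : ℕ} {f : V → Fin k} {i : Fin k} {u w : V} →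
                 ClassWalk R f i u w → f u ≡ i
classWalk-head (here fu≡i) = fu≡i
classWalk-head (step fu≡i _ _) = fu≡i

⌊n/2⌋+⌊n/2⌋≤n : ∀ n → ⌊ n /2⌋ + ⌊ n /2⌋ ≤ n
⌊n/2⌋+⌊n/2⌋≤n n = ≤-trans (+-monoʳ-≤ ⌊ n /2⌋ (⌊n/2⌋≤⌈n/2⌉ n)) (≤-reflexive (⌊n/2⌋+⌈n/2⌉≡n n))

-- (suc (suc n)) % 2 reduces to n % 2, so the induction needs no lemma on _%_.
odd⇒1+2⌊n/2⌋≡n : ∀ n → n % 2 ≡ 1 → suc (2 * ⌊ n /2⌋) ≡ n
odd⇒1+2⌊n/2⌋≡n zero ()
odd⇒1+2⌊n/2⌋≡n (suc zero) _ = refl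
odd⇒1+2⌊n/2⌋≡n (suc (suc n)) odd = cong (2 +_) (trans (+-suc ⌊ n /2⌋ (⌊ n /2⌋ + 0)) (odd⇒1+2⌊n/2⌋≡n n odd))

module Walks (G : Graph) where

  V : Set
  V = Fin (n G)

  private
    variable
      s t d : ℕ
      u v w x y : V

  data Walk : V → V → Set where
    nil  : Walk u u
    cons : Adj G u v → Walk v w → Walk u w

  inner : Walk u w → List V
  inner nil = []
  inner (cons {v = v} _ W) = v ∷ inner W

  verts : Walk u w → List V
  verts {u = u} W = u ∷ inner W

  len : Walk u w → ℕ
  len W = length (inner W)

  _++ʷ_ : Walk u v → Walk v w → Walk u w
  nil ++ʷ B = B
  cons a A ++ʷ B = cons a (A ++ʷ B)

  inner-++ʷ : (A : Walk u v) (B : Walk v w) → inner (A ++ʷ B) ≡ inner A ++ inner B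
  inner-++ʷ nil B = refl
  inner-++ʷ (cons a A) B = cong (_ ∷_) (inner-++ʷ A B)

  len-++ʷ : (A : Walk u v) (B : Walk v w) → len (A ++ʷ B) ≡ len A + len B
  len-++ʷ A B = trans (cong length (inner-++ʷ A B)) (length-++ (inner A))

  ∈-inner-++ʷ⁻ : (A : Walk u v) (B : Walk v w) → y ∈ inner (A ++ʷ B) → y ∈ inner A ⊎ y ∈ inner B
  ∈-inner-++ʷ⁻ A B y∈ = ∈-++⁻ (inner A) (subst (_ ∈_) (inner-++ʷ A B) y∈)

  ∈-verts-++ʷ⁻ : (A : Walk u v) (B : Walk v w) → y ∈ verts (A ++ʷ B) → y ∈ verts A ⊎ y ∈ inner B
  ∈-verts-++ʷ⁻ A B (here refl) = inj₁ (here refl)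
  ∈-verts-++ʷ⁻ A B (there y∈) with ∈-inner-++ʷ⁻ A B y∈
  ... | inj₁ y∈A = inj₁ (there y∈A)
  ... | inj₂ y∈B = inj₂ y∈B

  reverseʷ : Walk u w → Walk w u
  reverseʷ nil = nil
  reverseʷ (cons a W) = reverseʷ W ++ʷ cons (sym G a) nil

  len-reverseʷ : (W : Walk u w) → len (reverseʷ W) ≡ len W
  len-reverseʷ nil = refl
  len-reverseʷ (cons a W) = begin
    len (reverseʷ W ++ʷ cons (sym G a) nil) ≡⟨ len-++ʷ (reverseʷ W) _ ⟩
    len (reverseʷ W) + 1                    ≡⟨ cong (_+ 1) (len-reverseʷ W) ⟩
    len W + 1                               ≡⟨ +-comm (len W) 1 ⟩
    suc (len W)                             ∎
    where open ≡.≡-Reasoning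

  Within : ℕ → V → V → Set
  Within t u w = Σ (Walk u w) λ W → len W ≤ t

  Within-mono : s ≤ t → Within s u w → Within t u w
  Within-mono s≤t (W , W≤s) = W , ≤-trans W≤s s≤t

  Within-sym : Within t u w → Within t w u
  Within-sym (W , W≤t) = reverseʷ W , subst (_≤ _) (≡.sym (len-reverseʷ W)) W≤t

  Within-trans : Within s u v → Within t v w → Within (s + t) u w
  Within-trans (A , A≤s) (B , B≤t) = A ++ʷ B , subst (_≤ _) (≡.sym (len-++ʷ A B)) (+-mono-≤ A≤s B≤t)

  Within? : ∀ t u w → Dec (Within t u w)
  Within? t u w with u Fin.≟ w
  ... | yes refl = yes (nil , z≤n)
  Within? zero u w | no u≢w = no λ { (nil , _) → u≢w refl ; (cons _ _ , ()) }
  Within? (suc t) u w | no u≢w with Fin.any? (λ v → Adj? G u v ×-dec Within? t v w)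
  ... | yes (_ , a , W , W≤t) = yes (cons a W , s≤s W≤t)
  ... | no ∄step = no λ { (nil , _) → u≢w refl ; (cons a W , s≤s W≤t) → ∄step (_ , a , W , W≤t) }

  ∈verts⇒Within-start : (W : Walk u w) → y ∈ verts W → Within (len W) u y
  ∈verts⇒Within-start W (here refl) = nil , z≤n
  ∈verts⇒Within-start (cons a W) (there y∈) with ∈verts⇒Within-start W y∈
  ... | P , P≤W = cons a P , s≤s P≤W

  ∈verts⇒Within-end : (W : Walk u w) → y ∈ verts W → Within (len W) y w
  ∈verts⇒Within-end W (here refl) = W , ≤-refl
  ∈verts⇒Within-end (cons a W) (there y∈) = Within-mono (n≤1+n _) (∈verts⇒Within-end W y∈)

  ∈inner⇒Within-end : (W : Walk u w) → len W ≤ suc t → y ∈ inner W → Within t y w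
  ∈inner⇒Within-end (cons a W) (s≤s W≤t) y∈ = Within-mono W≤t (∈verts⇒Within-end W y∈)

  splitAt : ∀ s (W : Walk u w) → len W ≤ s + t →
            ∃ λ x → Σ (Walk u x) λ A → Σ (Walk x w) λ B → len A ≤ s × len B ≤ t
  splitAt zero W W≤t = _ , nil , W , z≤n , W≤t
  splitAt (suc s) nil _ = _ , nil , nil , z≤n , z≤n
  splitAt (suc s) (cons a W) (s≤s W≤s+t) with splitAt s W W≤s+t
  ... | _ , A , B , A≤s , B≤t = _ , cons a A , B , s≤s A≤s , B≤t

  Simple : Walk u w → Set
  Simple W = Unique (verts W)

  Shortcut : Walk u w → V → Set
  Shortcut {w = w} W x = Σ (Walk x w) λ P → Simple P × len P ≤ len W × verts P ⊆ verts W

  dropUntil : (W : Walk u w) → Simple W → x ∈ verts W → Shortcut W x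
  dropUntil W W! (here refl) = W , W! , ≤-refl , id
  dropUntil (cons a W) (_ ∷ W!) (there x∈) with dropUntil W W! x∈
  ... | P , P! , P≤W , P⊆W = P , P! , m≤n⇒m≤1+n P≤W , there ∘ P⊆W

  simplify : (W : Walk u w) → Shortcut W u
  simplify nil = nil , [] ∷ [] , z≤n , id
  simplify (cons {u = u} a W) with simplify W
  ... | P , P! , P≤W , P⊆W with Any.any? (u Fin.≟_) (verts P)
  ...   | yes u∈P with dropUntil P P! u∈P
  ...     | Q , Q! , Q≤P , Q⊆P = Q , Q! , m≤n⇒m≤1+n (≤-trans Q≤P P≤W) , there ∘ P⊆W ∘ Q⊆P
  simplify (cons a W) | P , P! , P≤W , P⊆W | no u∉P =
    cons a P , ¬Any⇒All¬ _ u∉P ∷ P! , s≤s P≤W , λ { (here e) → here e ; (there y∈) → there (P⊆W y∈) }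

  lookup-last : (W : Walk u w) → lookup (verts W) (fromℕ (len W)) ≡ w
  lookup-last nil = refl
  lookup-last (cons a W) = lookup-last W

  lookup-edge : (W : Walk u w) (i : Fin (len W)) → Adj G (lookup (verts W) (inject₁ i)) (lookup (verts W) (suc i))
  lookup-edge (cons a W) zero = a
  lookup-edge (cons a W) (suc i) = lookup-edge W i

  toPath : (W : Walk u w) → Simple W → Path G (len W)
  toPath W W! = record { vert = lookup (verts W) ; distinct = lookup-injective W! ; edges = lookup-edge W }

  walkThrough : (x : Fin (suc s) → V) → (∀ i → Adj G (x (inject₁ i)) (x (suc i))) → Within s (x zero) (x (fromℕ s))
  walkThrough {zero} x _ = nil , z≤n
  walkThrough {suc s} x e with walkThrough (x ∘ suc) (e ∘ suc)
  ... | W , W≤s = cons (e zero) W , s≤s W≤s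

  PowAdj⇒Within : PowAdj G d u w → Within d u w
  PowAdj⇒Within (_ , _ , s≤d , p , refl , refl) = Within-mono s≤d (walkThrough (vert p) (edges p))

  Within⇒≡⊎PowAdj : Within d u w → u ≡ w ⊎ PowAdj G d u w
  Within⇒≡⊎PowAdj {u = u} {w = w} (W , W≤d) with u Fin.≟ w | simplify W
  ... | yes u≡w | _ = inj₁ u≡w
  ... | no u≢w | P , P! , P≤W , _ = inj₂ (u≢w , len P , ≤-trans P≤W W≤d , toPath P P! , refl , lookup-last P)

module Reachability (G : Graph) (σ : Ordering G) where
  open Walks G

  position : V → ℕ
  position x = toℕ (pos σ x)

  position-injective : ∀ {x y} → position x ≡ position y → x ≡ y
  position-injective e = pos-inj σ (Fin.toℕ-injective e)

  hops≤ : ∀ {s} (p : Path G s) (Ys : List V) → (∀ j → IsHop σ p j → vert p (suc j) ∈ Ys) → hops σ p ≤ length Ys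
  hops≤ {s} p Ys hop∈Ys = begin
    hops σ p                      ≡⟨ length-map (vert p ∘ suc) J ⟨
    length (map (vert p ∘ suc) J) ≤⟨ unique-⊆⇒length≤ hopVerts! hopVerts⊆Ys ⟩
    length Ys                     ∎
    where
    open ≤-Reasoning
    J = filter (isHop? σ p) (allFin s)
    hopVerts! : Unique (map (vert p ∘ suc) J)
    hopVerts! = Unique.map⁺ (Fin.suc-injective ∘ distinct p) (Unique.filter⁺ (isHop? σ p) (Unique.allFin⁺ s))
    hopVerts⊆Ys : map (vert p ∘ suc) J ⊆ Ys
    hopVerts⊆Ys y∈ with ∈-map⁻ (vert p ∘ suc) y∈
    ... | j , j∈J , refl = hop∈Ys j (proj₂ (∈-filter⁻ (isHop? σ p) {xs = allFin s} j∈J))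

  -- The hops of the extracted path are σ-below its start, so the vertices
  -- of W that are σ-below v bound them.
  walk⇒GReach : ∀ {k ℓ v u} (W : Walk v u) (Ys : List V) → len W ≤ ℓ → length Ys ≤ k →
                (∀ {y} → y ∈ verts W → u ≤[ σ ] y) →
                (∀ {y} → y ∈ verts W → y <[ σ ] v → y ∈ Ys) →
                GReach k ℓ G σ v u
  walk⇒GReach W Ys W≤ℓ Ys≤k above below with simplify W
  ... | P , P! , P≤W , P⊆W =
    above (here refl) , len P , ≤-trans P≤W W≤ℓ , p , refl , lookup-last P , before-end ,
    ≤-trans (hops≤ p Ys hop∈Ys) Ys≤k
    where
    p = toPath P P!
    before-end : ∀ i → _ <[ σ ] vert p (inject₁ i)
    before-end i = ≤∧≢⇒< (above (P⊆W (∈-lookup (inject₁ i))))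
      λ same → Fin.fromℕ≢inject₁ {i = i} (lookup-injective P! (trans (lookup-last P) (position-injective same)))
    hop∈Ys : ∀ j → IsHop σ p j → vert p (suc j) ∈ Ys
    hop∈Ys j hop = below (P⊆W (∈-lookup (suc j))) (hop zero (s≤s z≤n))

  GReach-refl : ∀ {k ℓ} v → GReach k ℓ G σ v v
  GReach-refl v = walk⇒GReach nil [] z≤n z≤n (λ { (here refl) → ≤-refl }) λ { (here refl) v<v → contradiction v<v (<-irrefl refl) }

module GreedyColouring (G : Graph) (σ : Ordering G) {m : ℕ}
  (E : Fin (n G) → Fin (n G) → Set) (E? : ∀ y z → Dec (E y z))
  (few : ∀ z → AtMost m (λ y → y ≡ z ⊎ (y <[ σ ] z × E y z))) where
  open Walks G using (V)
  open Reachability G σ using (position; position-injective)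

  Earlier : V → V → Set
  Earlier y z = y <[ σ ] z × E y z

  earlier-≢ : ∀ {y z} → Earlier y z → y ≢ z
  earlier-≢ (y<y , _) refl = <-irrefl refl y<y

  Used : (V → Fin m) → V → Fin m → Set
  Used c z a = ∃ λ y → Earlier y z × c y ≡ a

  used? : ∀ c z a → Dec (Used c z a)
  used? c z a = Fin.any? λ y → ((pos σ y Fin.<? pos σ z) ×-dec E? y z) ×-dec (c y Fin.≟ a)

  -- If every colour were used, {z} and one earlier neighbour per colour would
  -- inject m + 1 elements into Fin m.
  freeColour : (c : V → Fin m) (z : V) → ∃ λ a → ∀ {y} → Earlier y z → c y ≢ a
  freeColour c z with Fin.all? (used? c z)
  ... | no ¬allUsed with Fin.¬∀⟶∃¬ m (Used c z) (used? c z) ¬allUsed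
  ...   | a , unused = a , λ earlier cy≡a → unused (_ , earlier , cy≡a)
  freeColour c z | yes allUsed = ⊥-elim (<-irrefl refl (Fin.injective⇒≤ F-injective))
    where
    g = proj₁ (few z)
    g-injective = proj₂ (few z)
    F : Fin (suc m) → Fin m
    F zero = g z (inj₁ refl)
    F (suc a) = g (proj₁ (allUsed a)) (inj₂ (proj₁ (proj₂ (allUsed a))))
    F-injective : Injective _≡_ _≡_ F
    F-injective {zero} {zero} _ = refl
    F-injective {zero} {suc b} e = ⊥-elim (earlier-≢ (proj₁ (proj₂ (allUsed b))) (≡.sym (g-injective _ _ _ _ e)))
    F-injective {suc a} {zero} e = ⊥-elim (earlier-≢ (proj₁ (proj₂ (allUsed a))) (g-injective _ _ _ _ e))
    F-injective {suc a} {suc b} e = cong suc (begin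
      a                      ≡⟨ proj₂ (proj₂ (allUsed a)) ⟨
      c (proj₁ (allUsed a))  ≡⟨ cong c (g-injective _ _ _ _ e) ⟩
      c (proj₁ (allUsed b))  ≡⟨ proj₂ (proj₂ (allUsed b)) ⟩
      b                      ∎)
      where open ≡.≡-Reasoning

  ProperBelow : ℕ → (V → Fin m) → Set
  ProperBelow k c = ∀ {y z} → position z < k → Earlier y z → c y ≢ c z

  recolour : (V → Fin m) → V → V → Fin m
  recolour c z = updateAt c z (const (proj₁ (freeColour c z)))

  recolour-proper : ∀ {k c z} → position z ≡ k → ProperBelow k c → ProperBelow (suc k) (recolour c z)
  recolour-proper {k} {c} {z} pz≡k proper {y} {x} x<1+k y<x with x Fin.≟ z
  ... | yes refl = λ same → proj₂ (freeColour c z) y<x (begin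
      c y              ≡⟨ updateAt-minimal y z c (earlier-≢ y<x) ⟨
      recolour c z y   ≡⟨ same ⟩
      recolour c z z   ≡⟨ updateAt-updates z c ⟩
      proj₁ (freeColour c z) ∎)
    where open ≡.≡-Reasoning
  ... | no x≢z = λ same → proper x<k y<x (begin
      c y              ≡⟨ updateAt-minimal y z c y≢z ⟨
      recolour c z y   ≡⟨ same ⟩
      recolour c z x   ≡⟨ updateAt-minimal x z c x≢z ⟩
      c x              ∎)
    where
    open ≡.≡-Reasoning
    x<k : position x < k
    x<k = ≤∧≢⇒< (≤-pred x<1+k) λ px≡k → x≢z (position-injective (trans px≡k (≡.sym pz≡k)))
    y≢z : y ≢ z
    y≢z refl = <-irrefl pz≡k (<-≤-trans (proj₁ y<x) (<⇒≤ x<k))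

  properBelow : ∀ k → Σ (V → Fin m) (ProperBelow k)
  properBelow zero = (λ z → proj₁ (few z) z (inj₁ refl)) , λ ()
  properBelow (suc k) with properBelow k | Fin.any? (λ z → position z ℕ.≟ k)
  ... | c , proper | yes (z , pz≡k) = recolour c z , recolour-proper pz≡k proper
  ... | c , proper | no ∄z = c , λ x<1+k → proper (≤∧≢⇒< (≤-pred x<1+k) λ px≡k → ∄z (_ , px≡k))

  greedyColouring : Σ (V → Fin m) λ c → ∀ {y z} → Earlier y z → c y ≢ c z
  greedyColouring with properBelow (n G)
  ... | c , proper = c , λ {_} {z} → proper (Fin.toℕ<n (pos σ z))

module PowerColouring (G : Graph) (σ : Ordering G) (d ℓ m : ℕ)
  (ℓ-large : d + 2 * ⌊ d /2⌋ ≤ ℓ) (gcol≤m : GcolAtMost d ℓ G σ m) where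
  open Walks G
  open Reachability G σ

  ρ ρ' : ℕ
  ρ = ⌊ d /2⌋
  ρ' = ⌈ d /2⌉

  root : V → V
  root v = argmin position v (filter (Within? ρ v) (allFin (n G)))

  root-within : ∀ v → Within ρ v (root v)
  root-within v = argmin-all position (nil , z≤n) (all-filter (Within? ρ v) (allFin (n G)))

  root-minimal : ∀ v {y} → Within ρ v y → root v ≤[ σ ] y
  root-minimal v {y} v~y =
    All.lookup (f[argmin]≤f[xs] v _) (∈-filter⁺ (Within? ρ v) (∈-allFin y) v~y)

  Conflict : V → V → Set
  Conflict y z = ∃ λ a → ∃ λ b → root a ≡ z × root b ≡ y × Within d a b

  conflict? : ∀ y z → Dec (Conflict y z)
  conflict? y z = Fin.any? λ a → Fin.any? λ b → (root a Fin.≟ z) ×-dec (root b Fin.≟ y) ×-dec Within? d a b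

  conflict⇒GReach : ∀ {y z} → y <[ σ ] z → Conflict y z → GReach d ℓ G σ z y
  conflict⇒GReach ry<rz (a , b , refl , refl , Wab , Wab≤d)
    with splitAt ρ Wab (≤-trans Wab≤d (≤-reflexive (≡.sym (⌊n/2⌋+⌈n/2⌉≡n d))))
  ... | _ , A , B , A≤ρ , B≤ρ' = walk⇒GReach W (inner T) W≤ℓ T≤d above below
    where
    Wra = proj₁ (Within-sym (root-within a))
    Wbr = proj₁ (root-within b)
    T = B ++ʷ Wbr
    W = Wra ++ʷ (A ++ʷ T)

    T≤d : len T ≤ d
    T≤d = begin
      len T           ≡⟨ len-++ʷ B Wbr ⟩
      len B + len Wbr ≤⟨ +-mono-≤ B≤ρ' (proj₂ (root-within b)) ⟩
      ρ' + ρ          ≡⟨ trans (+-comm ρ' ρ) (⌊n/2⌋+⌈n/2⌉≡n d) ⟩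
      d               ∎
      where open ≤-Reasoning

    W≤ℓ : len W ≤ ℓ
    W≤ℓ = begin
      len W                       ≡⟨ len-++ʷ Wra (A ++ʷ T) ⟩
      len Wra + len (A ++ʷ T)     ≡⟨ cong (len Wra +_) (len-++ʷ A T) ⟩
      len Wra + (len A + len T)   ≤⟨ +-mono-≤ (proj₂ (Within-sym (root-within a))) (+-mono-≤ A≤ρ T≤d) ⟩
      ρ + (ρ + d)                 ≡⟨ rearrange ρ d ⟩
      d + 2 * ρ                   ≤⟨ ℓ-large ⟩
      ℓ                           ∎
      where
      open ≤-Reasoning
      rearrange : ∀ x y → x + (x + y) ≡ y + 2 * x
      rearrange = solve-∀

    near-a-or-T : ∀ {y} → y ∈ verts W → Within ρ a y ⊎ y ∈ inner T
    near-a-or-T y∈ with ∈-verts-++ʷ⁻ Wra (A ++ʷ T) y∈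
    ... | inj₁ y∈Wra = inj₁ (Within-sym (Within-mono (proj₂ (Within-sym (root-within a))) (∈verts⇒Within-end Wra y∈Wra)))
    ... | inj₂ y∈AT with ∈-inner-++ʷ⁻ A T y∈AT
    ...   | inj₁ y∈A = inj₁ (Within-mono A≤ρ (∈verts⇒Within-start A (there y∈A)))
    ...   | inj₂ y∈T = inj₂ y∈T

    -- B has length at most ⌈d/2⌉ ≤ ρ + 1, so its inner vertices are within ρ of b.
    T-near-b : ∀ {y} → y ∈ inner T → Within ρ b y
    T-near-b y∈ with ∈-inner-++ʷ⁻ B Wbr y∈
    ... | inj₁ y∈B = Within-sym (∈inner⇒Within-end B (≤-trans B≤ρ' (⌊n/2⌋-mono (n≤1+n (suc d)))) y∈B)
    ... | inj₂ y∈Wbr = Within-mono (proj₂ (root-within b)) (∈verts⇒Within-start Wbr (there y∈Wbr))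

    above : ∀ {y} → y ∈ verts W → root b ≤[ σ ] y
    above y∈ = [ (λ a~y → ≤-trans (<⇒≤ ry<rz) (root-minimal a a~y)) , root-minimal b ∘ T-near-b ]′ (near-a-or-T y∈)

    below : ∀ {y} → y ∈ verts W → y <[ σ ] root a → y ∈ inner T
    below y∈ y<ra with near-a-or-T y∈
    ... | inj₁ a~y = contradiction y<ra (≤⇒≯ (root-minimal a a~y))
    ... | inj₂ y∈T = y∈T

  few : ∀ z → AtMost m (λ y → y ≡ z ⊎ (y <[ σ ] z × Conflict y z))
  few z = AtMost-mono (λ { _ (inj₁ refl) → GReach-refl z ; _ (inj₂ (y<z , c)) → conflict⇒GReach y<z c }) (gcol≤m z)

  open GreedyColouring G σ Conflict conflict? few using (greedyColouring)

  colour : V → Fin m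
  colour v = proj₁ greedyColouring (root v)

  same-root : ∀ {u w} → colour u ≡ colour w → PowAdj G d u w → root u ≡ root w
  same-root {u} {w} same adj with Fin.<-cmp (pos σ (root u)) (pos σ (root w))
  ... | tri< ru<rw _ _ = contradiction same (proj₂ greedyColouring (ru<rw , w , u , refl , refl , Within-sym (PowAdj⇒Within adj)))
  ... | tri≈ _ same-pos _ = pos-inj σ same-pos
  ... | tri> _ _ rw<ru = contradiction (≡.sym same) (proj₂ greedyColouring (rw<ru , u , w , refl , refl , PowAdj⇒Within adj))

  classWalk-root : ∀ {i u w} → ClassWalk (PowAdj G d) colour i u w → root u ≡ root w
  classWalk-root (here _) = refl
  classWalk-root (step u∈i adj rest) = trans (same-root (trans u∈i (≡.sym (classWalk-head rest))) adj) (classWalk-root rest)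

  isSubcolouring : IsSubcolouring (PowAdj G d) colour
  isSubcolouring _ u w walk =
    Within⇒≡⊎PowAdj (Within-mono (⌊n/2⌋+⌊n/2⌋≤n d)
      (Within-trans (root-within u) (subst (λ r → Within ρ r w) (≡.sym (classWalk-root walk)) (Within-sym (root-within w)))))

subcolouringOfPower : (G : Graph) (σ : Ordering G) (d ℓ m : ℕ) →
                      d + 2 * ⌊ d /2⌋ ≤ ℓ → GcolAtMost d ℓ G σ m → HasSubcolouringPow G d m
subcolouringOfPower G σ d ℓ m ℓ-large gcol≤m = colour , isSubcolouring
  where open PowerColouring G σ d ℓ m ℓ-large gcol≤m

-- The bound also holds for d = 0.
mainTheorem1 : (G : Graph) (d : ℕ) → 1 ≤ d →
    ((σ : Ordering G) (m : ℕ) → GcolAtMost d (2 * d) G σ m → HasSubcolouringPow G d m)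
    × (d % 2 ≡ 1 →
       (σ : Ordering G) (m : ℕ) → GcolAtMost d (2 * d ∸ 1) G σ m → HasSubcolouringPow G d m)
mainTheorem1 G d _ =
  (λ σ m → subcolouringOfPower G σ d (2 * d) m even-bound) ,
  (λ odd σ m → subcolouringOfPower G σ d (2 * d ∸ 1) m (odd-bound odd))
  where
  open ≤-Reasoning
  even-bound : d + 2 * ⌊ d /2⌋ ≤ 2 * d
  even-bound = begin
    d + 2 * ⌊ d /2⌋          ≡⟨ cong (d +_) (cong (⌊ d /2⌋ +_) (+-identityʳ ⌊ d /2⌋)) ⟩
    d + (⌊ d /2⌋ + ⌊ d /2⌋)  ≤⟨ +-monoʳ-≤ d (⌊n/2⌋+⌊n/2⌋≤n d) ⟩
    d + d                    ≡⟨ cong (d +_) (+-identityʳ d) ⟨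
    2 * d                    ∎
  odd-bound : d % 2 ≡ 1 → d + 2 * ⌊ d /2⌋ ≤ 2 * d ∸ 1
  odd-bound odd = begin
    d + 2 * ⌊ d /2⌋              ≡⟨ +-comm d _ ⟩
    suc (2 * ⌊ d /2⌋) + d ∸ 1    ≡⟨ cong (λ k → k + d ∸ 1) (odd⇒1+2⌊n/2⌋≡n d odd) ⟩
    d + d ∸ 1                    ≡⟨ cong (λ k → d + k ∸ 1) (+-identityʳ d) ⟨
    2 * d ∸ 1                    ∎
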